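{- Let $q\ge 5$ be a prime, $B=\frac{q-1}{2}$, and $c\ge 1$. For an integer $i$ with $0\le i<B^{c+1}$ write $i=\sum_{k=0}^{c} b_k B^k$ with digits $0\le b_k<B$; its base polynomial is $\sum_{k=0}^{c} b_kX^k\in\mathbb{F}_q[X]$. For each subset $S\subseteq\{0,\dots,c-1\}$ define $$Q_{i,S}(X)=\sum_{k=0}^{c}\Big(b_k+B\cdot[k\in S]-[k-1\in S]\Big)X^k\in\mathbb{F}_q[X],$$ (these are the $2^c$ polynomials obtained from the base polynomial by choosing, for each coefficient except the highest-degree one, either to leave it or to add $B$ to it and decrease the next-higher coefficient by $1$), so $Q_{i,\emptyset}$ is the base polynomial; the pattern index $j$ is represented by its base polynomial $A_j=Q_{j,\emptyset}$, and index $0$ by the zero polynomial. Then for all integers $i,j\ge 0$ with $i+j<B^{c+1}$ and every assignment $x\in\mathbb{F}_q$: if $P[0]$ (at position $0$) is aligned with the base polynomial of $T[i]$ (at position $Q_{i,\emptyset}(x)$), then $P[j]$ is aligned with one of the polynomials representing $T[i+j]$, i.e. there exists $S\subseteq\{0,\dots,c-1\}$ with $$Q_{i,\emptyset}(x)+A_j(x)=Q_{i+j,S}(x)\quad\text{in }\mathbb{F}_q.$$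
   Context: Here $[\cdot]$ is the indicator (1 if the condition holds, 0 otherwise), and arithmetic of coefficients and evaluations is in the prime field $\mathbb{F}_q$. An assignment $x$ maps each text index to the positions (in a vector of length $q$) given by evaluating its polynomials at $x$ and each pattern index to its base polynomial evaluated at $x$; alignment means a common additive shift in $\mathbb{F}_q$. -}

module Defs where

open import Data.Nat using (ℕ; zero; suc; _%_; _/_)
open import Data.Integer using (ℤ; +_; _+_; _-_; _*_; _^_; 0ℤ; 1ℤ)
open import Data.Integer.Divisibility using (_∣_)
open import Data.Bool using (true; false)
open import Data.Vec using ([]; _∷_)
open import Data.Fin.Subset using (Subset)

-- k-th base-B digit of i (B ≥ 2 in the application; B = 0 yields 0)
digit : ℕ → ℕ → ℕ → ℕ
digit zero    i k       = 0
digit (suc b) i zero    = i % suc b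
digit (suc b) i (suc k) = digit (suc b) (i / suc b) k

memb : ∀ {c} → Subset c → ℕ → ℤ
memb []          k       = 0ℤ
memb (true ∷ S)  zero    = 1ℤ
memb (false ∷ S) zero    = 0ℤ
memb (_ ∷ S)     (suc k) = memb S k

prevMemb : ∀ {c} → Subset c → ℕ → ℤ
prevMemb S zero    = 0ℤ
prevMemb S (suc k) = memb S k

sumTo : ℕ → (ℕ → ℤ) → ℤ
sumTo zero    f = 0ℤ
sumTo (suc n) f = sumTo n f + f n

evalQ : (B c i : ℕ) → Subset c → ℤ → ℤ
evalQ B c i S x =
  sumTo (suc c) (λ k → ((+ digit B i k) + (+ B) * memb S k - prevMemb S k) * (x ^ k))

_≡_[mod_] : ℤ → ℤ → ℕ → Set
a ≡ b [mod q ] = (+ q) ∣ (a - b)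

module Submission where

-- The alignment property holds for a reason that has nothing to do with 𝔽_q:
-- Q_{i,∅}(X) + Q_{j,∅}(X) = Q_{i+j,S}(X) already as polynomials over ℤ, where S
-- is the set of positions that produce a carry in the schoolbook addition of i
-- and j in base B.  Indeed, at position k the column sum satisfies
--     [k-1 ∈ S] + b_k(i) + b_k(j) = b_k(i+j) + B·[k ∈ S],
-- which rearranges to  b_k(i) + b_k(j) = b_k(i+j) + B·[k ∈ S] − [k-1 ∈ S],
-- the k-th coefficient of Q_{i+j,S}.  The bound i + j < B^{c+1} guarantees that
-- there is no carry out of the top position c, so S ⊆ {0,…,c-1}.
--
-- The theorem is the case
-- B = (q-1)/2: B = 0 is impossible under the bound i + j < B^{c+1}, and equal
-- integers are congruent modulo q.

open import Defs
open import Data.Nat using (ℕ; suc; _+_; _∸_; _/_; _^_; _≤_; _<_)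
open import Data.Nat.Primality using (Prime)
open import Data.Integer using (+_)
import Data.Integer as ℤ
open import Data.Fin using (Fin; toℕ)
open import Data.Fin.Subset using (Subset; ⊥)
open import Data.Product using (∃-syntax)

open import Data.Nat using (zero; _*_; _%_; z≤n; s≤s; _<?_)
open import Data.Nat.Properties
  using (+-identityʳ; n≤1+n; ≤-refl; *-zeroʳ; *-identityʳ; *-comm; ≤-pred; ≤-trans; ≤-<-trans;
         m≤m+n; m≤n+m; +-mono-≤; +-mono-≤-<; ≮⇒≥; m∸n+n≡m; m<n+o⇒m∸n<o)
open import Data.Nat.DivMod
  using (m≡m%n+[m/n]*n; [m+kn]%n≡m%n; m<n⇒m%n≡m; m<n⇒m/n≡0; m*n/n≡m;
         +-distrib-/-∣ʳ; m%n<n; m<n*o⇒m/o<n)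
open import Data.Nat.Divisibility using (divides-refl; _∣0)
open import Data.Integer.Divisibility using (_∣_)
import Data.Integer.Properties as ℤP
import Data.Nat.Tactic.RingSolver as ℕ-Solver
import Data.Integer.Tactic.RingSolver as ℤ-Solver
open import Data.Bool using (Bool; true; false)
open import Data.Vec using ([]; _∷_)
open import Data.Product using (Σ; _×_; _,_; ∃₂; proj₁; proj₂)
open import Relation.Binary.PropositionalEquality
  using (_≡_; refl; sym; trans; cong; cong₂; subst; module ≡-Reasoning)
open import Relation.Nullary using (yes; no)

bit : Bool → ℕ
bit false = 0
bit true  = 1

bit≤1 : ∀ e → bit e ≤ 1
bit≤1 false = z≤n
bit≤1 true  = s≤s z≤n

memb-head : ∀ {n} e (S : Subset n) → memb (e ∷ S) 0 ≡ + bit e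
memb-head false S = refl
memb-head true  S = refl

memb-tail : ∀ {n} e (S : Subset n) k → memb (e ∷ S) (suc k) ≡ memb S k
memb-tail false S k = refl
memb-tail true  S k = refl

prevMemb-shift : ∀ {n} (S : Subset n) k → prevMemb S k ≡ memb (false ∷ S) k
prevMemb-shift S zero    = refl
prevMemb-shift S (suc k) = refl

memb-⊥ : ∀ n k → memb (⊥ {n}) k ≡ ℤ.0ℤ
memb-⊥ zero    k       = refl
memb-⊥ (suc n) zero    = refl
memb-⊥ (suc n) (suc k) = memb-⊥ n k

prevMemb-⊥ : ∀ n k → prevMemb (⊥ {n}) k ≡ ℤ.0ℤ
prevMemb-⊥ n zero    = refl
prevMemb-⊥ n (suc k) = memb-⊥ n k

column-ℤ : ∀ e a b d B m → e + a + b ≡ d + B * m →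
           + e ℤ.+ + a ℤ.+ + b ≡ + d ℤ.+ + B ℤ.* + m
column-ℤ e a b d B m eq = begin
  + e ℤ.+ + a ℤ.+ + b   ≡⟨ cong (ℤ._+ + b) (sym (ℤP.pos-+ e a)) ⟩
  + (e + a) ℤ.+ + b     ≡⟨ sym (ℤP.pos-+ (e + a) b) ⟩
  + (e + a + b)         ≡⟨ cong +_ eq ⟩
  + (d + B * m)         ≡⟨ ℤP.pos-+ d (B * m) ⟩
  + d ℤ.+ + (B * m)     ≡⟨ cong (ℤ._+_ (+ d)) (ℤP.pos-* B m) ⟩
  + d ℤ.+ + B ℤ.* + m   ∎
  where open ≡-Reasoning

sumTo-+ : ∀ n f g → sumTo n f ℤ.+ sumTo n g ≡ sumTo n (λ k → f k ℤ.+ g k)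
sumTo-+ zero    f g = refl
sumTo-+ (suc n) f g = begin
  sumTo n f ℤ.+ f n ℤ.+ (sumTo n g ℤ.+ g n)  ≡⟨ interchange (sumTo n f) (f n) (sumTo n g) (g n) ⟩
  sumTo n f ℤ.+ sumTo n g ℤ.+ (f n ℤ.+ g n)  ≡⟨ cong (ℤ._+ (f n ℤ.+ g n)) (sumTo-+ n f g) ⟩
  sumTo n (λ k → f k ℤ.+ g k) ℤ.+ (f n ℤ.+ g n) ∎
  where
  open ≡-Reasoning
  interchange : ∀ a b c d → a ℤ.+ b ℤ.+ (c ℤ.+ d) ≡ a ℤ.+ c ℤ.+ (b ℤ.+ d)
  interchange = ℤ-Solver.solve-∀

sumTo-cong : ∀ n f g → (∀ k → k < n → f k ≡ g k) → sumTo n f ≡ sumTo n g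
sumTo-cong zero    f g f≗g = refl
sumTo-cong (suc n) f g f≗g =
  cong₂ ℤ._+_ (sumTo-cong n f g (λ k k<n → f≗g k (≤-trans k<n (n≤1+n n)))) (f≗g n ≤-refl)

evalQ-base : ∀ B c i y → evalQ B c i ⊥ y ≡ sumTo (suc c) (λ k → + digit B i k ℤ.* y ℤ.^ k)
evalQ-base B c i y = sumTo-cong (suc c) _ _ (λ k _ → cong (ℤ._* y ℤ.^ k) (base-coefficient k))
  where
  no-shift : ∀ d B → d ℤ.+ B ℤ.* ℤ.0ℤ ℤ.- ℤ.0ℤ ≡ d
  no-shift = ℤ-Solver.solve-∀
  base-coefficient : ∀ k → + digit B i k ℤ.+ + B ℤ.* memb (⊥ {c}) k ℤ.- prevMemb (⊥ {c}) k
                           ≡ + digit B i k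
  base-coefficient k rewrite memb-⊥ c k | prevMemb-⊥ c k = no-shift (+ digit B i k) (+ B)

evalQ-add : ∀ B c i j N (S : Subset c) y →
  (∀ k → k ≤ c → + digit B i k ℤ.+ + digit B j k
                   ≡ + digit B N k ℤ.+ + B ℤ.* memb S k ℤ.- prevMemb S k) →
  evalQ B c i ⊥ y ℤ.+ evalQ B c j ⊥ y ≡ evalQ B c N S y
evalQ-add B c i j N S y coefficient = begin
  evalQ B c i ⊥ y ℤ.+ evalQ B c j ⊥ y
    ≡⟨ cong₂ ℤ._+_ (evalQ-base B c i y) (evalQ-base B c j y) ⟩
  sumTo (suc c) (λ k → + digit B i k ℤ.* y ℤ.^ k) ℤ.+ sumTo (suc c) (λ k → + digit B j k ℤ.* y ℤ.^ k)
    ≡⟨ sumTo-+ (suc c) _ _ ⟩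
  sumTo (suc c) (λ k → + digit B i k ℤ.* y ℤ.^ k ℤ.+ + digit B j k ℤ.* y ℤ.^ k)
    ≡⟨ sumTo-cong (suc c) _ _ term ⟩
  evalQ B c N S y ∎
  where
  open ≡-Reasoning
  term : ∀ k → k < suc c →
    + digit B i k ℤ.* y ℤ.^ k ℤ.+ + digit B j k ℤ.* y ℤ.^ k
      ≡ (+ digit B N k ℤ.+ + B ℤ.* memb S k ℤ.- prevMemb S k) ℤ.* y ℤ.^ k
  term k (s≤s k≤c) = trans (sym (ℤP.*-distribʳ-+ (y ℤ.^ k) (+ digit B i k) (+ digit B j k)))
                           (cong (ℤ._* y ℤ.^ k) (coefficient k k≤c))

move-carry : ∀ p a b s → p ℤ.+ a ℤ.+ b ≡ s → a ℤ.+ b ≡ s ℤ.- p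
move-carry p a b s eq = begin
  a ℤ.+ b              ≡⟨ cancel p a b ⟩
  p ℤ.+ a ℤ.+ b ℤ.- p  ≡⟨ cong (ℤ._- p) eq ⟩
  s ℤ.- p              ∎
  where
  open ≡-Reasoning
  cancel : ∀ p a b → a ℤ.+ b ≡ p ℤ.+ a ℤ.+ b ℤ.- p
  cancel = ℤ-Solver.solve-∀

≡⇒≡-mod : ∀ {a b} q → a ≡ b → a ≡ b [mod q ]
≡⇒≡-mod {a} {b} q a≡b =
  subst ((+ q) ∣_) (sym (trans (cong (ℤ._- b) a≡b) (ℤP.+-inverseʳ b))) (q ∣0)

-- Positional arithmetic in base B = b + 1 (the digit function of Defs only
-- computes for a successor base).
module Positional (b : ℕ) where

  B : ℕ
  B = suc b

  divMod-unique : ∀ r k → r < B → (r + k * B) % B ≡ r × (r + k * B) / B ≡ k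
  divMod-unique r k r<B =
    trans ([m+kn]%n≡m%n r k B) (m<n⇒m%n≡m r<B) ,
    trans (+-distrib-/-∣ʳ r (divides-refl k)) (cong₂ _+_ (m<n⇒m/n≡0 r<B) (m*n/n≡m k B))

  column : ∀ e r₁ r₂ → r₁ < B → r₂ < B →
           ∃₂ λ c t → t < B × bit e + r₁ + r₂ ≡ t + B * bit c
  column e r₁ r₂ r₁<B r₂<B with bit e + r₁ + r₂ <? B
  ... | yes s<B = false , bit e + r₁ + r₂ , s<B ,
                  sym (trans (cong (_+_ (bit e + r₁ + r₂)) (*-zeroʳ B)) (+-identityʳ _))
  ... | no  s≮B = true , s ∸ B , m<n+o⇒m∸n<o s B s<B+B ,
                  trans (sym (m∸n+n≡m (≮⇒≥ s≮B))) (cong (_+_ (s ∸ B)) (sym (*-identityʳ B)))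
    where
    s : ℕ
    s = bit e + r₁ + r₂
    s<B+B : s < B + B
    s<B+B = +-mono-≤-< (+-mono-≤ (bit≤1 e) (≤-pred r₁<B)) r₂<B

  low-column : ∀ e i j → ∃₂ λ c t →
    bit e + i % B + j % B ≡ t + B * bit c ×
    (bit e + i + j) % B ≡ t × (bit e + i + j) / B ≡ bit c + i / B + j / B
  low-column e i j with column e (i % B) (j % B) (m%n<n i B) (m%n<n j B)
  ... | c , t , t<B , col =
    c , t , col , subst (λ N → N % B ≡ t × N / B ≡ k) (sym split) (divMod-unique t k t<B)
    where
    open ≡-Reasoning
    k : ℕ
    k = bit c + i / B + j / B
    regroup : ∀ e r₁ q₁ r₂ q₂ B → e + (r₁ + q₁ * B) + (r₂ + q₂ * B) ≡ e + r₁ + r₂ + (q₁ + q₂) * B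
    regroup = ℕ-Solver.solve-∀
    absorb : ∀ t B c q₁ q₂ → t + B * c + (q₁ + q₂) * B ≡ t + (c + q₁ + q₂) * B
    absorb = ℕ-Solver.solve-∀
    split : bit e + i + j ≡ t + k * B
    split = begin
      bit e + i + j
        ≡⟨ cong₂ (λ u v → bit e + u + v) (m≡m%n+[m/n]*n i B) (m≡m%n+[m/n]*n j B) ⟩
      bit e + (i % B + i / B * B) + (j % B + j / B * B)
        ≡⟨ regroup (bit e) (i % B) (i / B) (j % B) (j / B) B ⟩
      bit e + i % B + j % B + (i / B + j / B) * B
        ≡⟨ cong (_+ (i / B + j / B) * B) col ⟩
      t + B * bit c + (i / B + j / B) * B
        ≡⟨ absorb t B (bit c) (i / B) (j / B) ⟩
      t + k * B ∎

  -- S is a carry set for the addition e + i + j in the columns 0,…,n: in every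
  -- column the carry in ([k-1 ∈ S], or e for k = 0) plus the two digits equals
  -- the digit of the sum plus B times the carry out [k ∈ S].
  IsCarrySet : ∀ {n} → Bool → ℕ → ℕ → Subset n → Set
  IsCarrySet {n} e i j S = ∀ k → k ≤ n →
    memb (e ∷ S) k ℤ.+ + digit B i k ℤ.+ + digit B j k
      ≡ + digit B (bit e + i + j) k ℤ.+ + B ℤ.* memb S k

  carries : ∀ n e i j → bit e + i + j < B ^ suc n → Σ (Subset n) (IsCarrySet e i j)
  carries zero e i j N<B^1 = [] , single-column
    where
    N<B : bit e + i + j < B
    N<B = subst (bit e + i + j <_) (*-identityʳ B) N<B^1
    i<B : i < B
    i<B = ≤-<-trans (≤-trans (m≤n+m i (bit e)) (m≤m+n (bit e + i) j)) N<B
    j<B : j < B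
    j<B = ≤-<-trans (m≤n+m j (bit e + i)) N<B
    no-carry : bit e + i % B + j % B ≡ (bit e + i + j) % B + B * 0
    no-carry = begin
      bit e + i % B + j % B      ≡⟨ cong₂ (λ u v → bit e + u + v) (m<n⇒m%n≡m i<B) (m<n⇒m%n≡m j<B) ⟩
      bit e + i + j              ≡⟨ sym (m<n⇒m%n≡m N<B) ⟩
      (bit e + i + j) % B        ≡⟨ sym (+-identityʳ _) ⟩
      (bit e + i + j) % B + 0    ≡⟨ cong (_+_ ((bit e + i + j) % B)) (sym (*-zeroʳ B)) ⟩
      (bit e + i + j) % B + B * 0 ∎
      where open ≡-Reasoning
    single-column : IsCarrySet e i j []
    single-column zero z≤n =
      trans (cong (λ z → z ℤ.+ + (i % B) ℤ.+ + (j % B)) (memb-head e []))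
            (column-ℤ (bit e) (i % B) (j % B) _ B 0 no-carry)
  carries (suc n) e i j N<B^n+2 with low-column e i j
  ... | c , t , col , N%B≡t , N/B≡high = (c ∷ S) , all-columns
    where
    N : ℕ
    N = bit e + i + j
    high-bound : bit c + i / B + j / B < B ^ suc n
    high-bound = subst (_< B ^ suc n) N/B≡high
                   (m<n*o⇒m/o<n (subst (N <_) (*-comm B (B ^ suc n)) N<B^n+2))
    high : Σ (Subset n) (IsCarrySet c (i / B) (j / B))
    high = carries n c (i / B) (j / B) high-bound
    S : Subset n
    S = proj₁ high
    all-columns : IsCarrySet e i j (c ∷ S)
    all-columns zero _ = begin
      memb (e ∷ c ∷ S) 0 ℤ.+ + (i % B) ℤ.+ + (j % B)
        ≡⟨ cong (λ z → z ℤ.+ + (i % B) ℤ.+ + (j % B)) (memb-head e _) ⟩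
      + bit e ℤ.+ + (i % B) ℤ.+ + (j % B)
        ≡⟨ column-ℤ (bit e) (i % B) (j % B) t B (bit c) col ⟩
      + t ℤ.+ + B ℤ.* + bit c
        ≡⟨ cong₂ (λ u v → + u ℤ.+ + B ℤ.* v) (sym N%B≡t) (sym (memb-head c S)) ⟩
      + (N % B) ℤ.+ + B ℤ.* memb (c ∷ S) 0 ∎
      where open ≡-Reasoning
    all-columns (suc k) (s≤s k≤n) = begin
      memb (e ∷ c ∷ S) (suc k) ℤ.+ + digit B (i / B) k ℤ.+ + digit B (j / B) k
        ≡⟨ cong (λ z → z ℤ.+ + digit B (i / B) k ℤ.+ + digit B (j / B) k) (memb-tail e (c ∷ S) k) ⟩
      memb (c ∷ S) k ℤ.+ + digit B (i / B) k ℤ.+ + digit B (j / B) k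
        ≡⟨ proj₂ high k k≤n ⟩
      + digit B (bit c + i / B + j / B) k ℤ.+ + B ℤ.* memb S k
        ≡⟨ cong₂ (λ M z → + digit B M k ℤ.+ + B ℤ.* z) (sym N/B≡high) (sym (memb-tail c S k)) ⟩
      + digit B (N / B) k ℤ.+ + B ℤ.* memb (c ∷ S) (suc k) ∎
      where open ≡-Reasoning

  sum-of-base-polynomials : ∀ c i j y → i + j < B ^ suc c →
    ∃[ S ] (evalQ B c i ⊥ y ℤ.+ evalQ B c j ⊥ y ≡ evalQ B c (i + j) S y)
  sum-of-base-polynomials c i j y bound with carries c false i j bound
  ... | S , carry = S , evalQ-add B c i j (i + j) S y coefficient
    where
    coefficient : ∀ k → k ≤ c → + digit B i k ℤ.+ + digit B j k
                                  ≡ + digit B (i + j) k ℤ.+ + B ℤ.* memb S k ℤ.- prevMemb S k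
    coefficient k k≤c = move-carry (prevMemb S k) _ _ _
      (trans (cong (λ z → z ℤ.+ + digit B i k ℤ.+ + digit B j k) (prevMemb-shift S k))
             (carry k k≤c))

lemma4 : (q c : ℕ) → Prime q → 5 ≤ q → 1 ≤ c →
    (i j : ℕ) → i + j < ((q ∸ 1) / 2) ^ suc c → (x : Fin q) →
    ∃[ S ] ((evalQ ((q ∸ 1) / 2) c i ⊥ (+ toℕ x) ℤ.+ evalQ ((q ∸ 1) / 2) c j ⊥ (+ toℕ x))
             ≡ evalQ ((q ∸ 1) / 2) c (i + j) S (+ toℕ x) [mod q ])
lemma4 q c _ _ _ i j bound x with (q ∸ 1) / 2 | bound
... | zero  | ()
... | suc b | bound′ with Positional.sum-of-base-polynomials b c i j (+ toℕ x) bound′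
...   | S , identity = S , ≡⇒≡-mod q identity
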